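{- Let $C_n$ denote the cycle on $n\ge 3$ vertices. If $n\ge 6$ or $n=4$, then $\chi_{\mu_i}(C_n)=\chi_\mu(C_n)=\lceil n/3\rceil$. Moreover, $\chi_{\mu_i}(C_n)=3$ for $n\in\{3,5\}$, $\chi_\mu(C_5)=2$ and $\chi_\mu(C_3)=1$.
   Context: All graphs are finite and simple. A geodesic is a shortest path. For $X\subseteq V(G)$, two vertices $x,y\in X$ are $X$-visible if some $x,y$-geodesic has no internal vertex in $X$. $X$ is a mutual-visibility (MV) set if every two of its vertices are $X$-visible, and an independent mutual-visibility (IMV) set if moreover it is independent. $\chi_\mu(G)$ (resp. $\chi_{\mu_i}(G)$) is the least $k$ such that $V(G)$ can be partitioned into $k$ MV sets (resp. IMV sets). -}

module Defs where

open import Data.Nat using (ℕ; zero; suc; _+_; _≤_; _/_)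
open import Data.Fin using (Fin; toℕ)
open import Data.Product using (Σ; _×_; _,_)
open import Data.Sum using (_⊎_)
open import Data.List using (List; []; _∷_)
open import Data.List.Relation.Unary.All using (All)
open import Relation.Nullary using (¬_)
open import Relation.Binary.PropositionalEquality using (_≡_)

module _ {V : Set} (Adj : V → V → Set) where

  data Walk : V → V → Set where
    []  : ∀ {x} → Walk x x
    _∷_ : ∀ {x y z} → Adj x y → Walk y z → Walk x z

  len : ∀ {x y} → Walk x y → ℕ
  len []      = zero
  len (_ ∷ w) = suc (len w)

  inner : ∀ {x y} → Walk x y → List V
  inner []                        = []
  inner (_ ∷ [])                  = []
  inner (_∷_ {y = v} _ (e ∷ w))   = v ∷ inner (e ∷ w)

  -- a geodesic is a shortest x,y-walk (hence a shortest path)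
  IsGeodesic : ∀ {x y} → Walk x y → Set
  IsGeodesic {x} {y} w = (w' : Walk x y) → len w ≤ len w'

  Visible : (V → Set) → V → V → Set
  Visible X x y = Σ (Walk x y) λ w → IsGeodesic w × All (λ v → ¬ X v) (inner w)

  IsMV : (V → Set) → Set
  IsMV X = ∀ x y → X x → X y → Visible X x y

  IsIndependent : (V → Set) → Set
  IsIndependent X = ∀ x y → X x → X y → ¬ Adj x y

  IsIMV : (V → Set) → Set
  IsIMV X = IsIndependent X × IsMV X

  Class : ∀ {k} → (V → Fin k) → Fin k → V → Set
  Class c i v = c v ≡ i

  -- V can be partitioned into (at most) k MV / IMV sets, given as colour classes
  MVPartition : ℕ → Set
  MVPartition k = Σ (V → Fin k) λ c → ∀ i → IsMV (Class c i)

  IMVPartition : ℕ → Set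
  IMVPartition k = Σ (V → Fin k) λ c → ∀ i → IsIMV (Class c i)

  IsChiMu : ℕ → Set
  IsChiMu k = MVPartition k × (∀ k' → MVPartition k' → k ≤ k')

  IsChiMuI : ℕ → Set
  IsChiMuI k = IMVPartition k × (∀ k' → IMVPartition k' → k ≤ k')

CycleAdj : (n : ℕ) → Fin n → Fin n → Set
CycleAdj n i j =
  (toℕ j ≡ suc (toℕ i)) ⊎ (toℕ i ≡ suc (toℕ j))
  ⊎ ((toℕ i ≡ 0 × suc (toℕ j) ≡ n) ⊎ (toℕ j ≡ 0 × suc (toℕ i) ≡ n))

ceil3 : ℕ → ℕ
ceil3 n = (n + 2) / 3

module Submission where

-- Upper bounds: with k = ⌈n/3⌉, colour i is used at the vertices i, i + k and i + k + d₁ (when they exist),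
-- where the three gaps k, d₁, d₂ around the cycle differ by at most one. Two vertices of a colour class are then
-- joined by an arc of at most half the cycle with no further vertex of the class inside; such an arc is a
-- geodesic, so every class is a mutual-visibility set, and it is independent as soon as these arcs have length
-- at least 2, which holds for n ≥ 6 and n = 4.
-- Lower bounds: if a < b < c < d on the cycle, every a,c-walk passes through b or d, so a mutual-visibility
-- set has at most three vertices and n ≤ 3 χ_μ(C_n). In C₃ and C₅ an independent set has at most one,
-- respectively two, vertices.

open import Defs
open import Data.Nat using (ℕ; zero; suc; _+_; _*_; _∸_; _≤_; _<_; z≤n; s≤s; s≤s⁻¹; _<?_)
open import Data.Nat.Properties
open import Data.Nat.DivMod using (m<n*o⇒m/o<n; m/n≡1+[m∸n]/n)
open import Data.Fin using (Fin; toℕ; fromℕ<; combine; #_)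
open import Data.Vec using (lookup; []; _∷_)
open import Data.Fin.Properties using (toℕ-injective; toℕ<n; toℕ-fromℕ<; fromℕ<-toℕ; injective⇒≤; combine-injective; all?) renaming (_≟_ to _≟ᶠ_)
open import Data.Product using (Σ; ∃; _×_; _,_; proj₁; proj₂)
open import Data.Sum using (_⊎_; inj₁; inj₂)
open import Data.List.Relation.Unary.All using (All; []; _∷_)
open import Data.Empty using (⊥; ⊥-elim)
open import Data.Unit using (⊤; tt)
open import Relation.Nullary using (¬_; Dec; yes; no)
open import Relation.Nullary.Decidable using (_×-dec_; _⊎-dec_; _→-dec_; ¬?; from-yes)
open import Relation.Binary.PropositionalEquality
open import Data.Nat.Tactic.RingSolver using (solve-∀)
open import Function using (_∘_)

module _ {V : Set} {Adj : V → V → Set} where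

  NonEmpty : ∀ {x y} → Walk Adj x y → Set
  NonEmpty []      = ⊥
  NonEmpty (_ ∷ _) = ⊤

  module _ {P : V → Set} where

    inner-tail : ∀ {x u y} (e : Adj x u) (w : Walk Adj u y) → All P (inner Adj (e ∷ w)) → All P (inner Adj w)
    inner-tail e []      _        = []
    inner-tail e (_ ∷ _) (_ ∷ pw) = pw

    inner-head : ∀ {x u y} (e : Adj x u) (w : Walk Adj u y) → All P (inner Adj (e ∷ w)) → NonEmpty w → P u
    inner-head e (_ ∷ _) (pu ∷ _) _ = pu

    inner-cons : ∀ {x u y} (e : Adj x u) (w : Walk Adj u y) → (NonEmpty w → P u) → All P (inner Adj w)
               → All P (inner Adj (e ∷ w))
    inner-cons e []      _  _  = []
    inner-cons e (_ ∷ _) pu pw = pu tt ∷ pw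

  module _ (Adj-sym : ∀ {x y} → Adj x y → Adj y x) where

    reverseOnto : ∀ {x y z} → Walk Adj x y → Walk Adj x z → Walk Adj y z
    reverseOnto []      acc = acc
    reverseOnto (e ∷ w) acc = reverseOnto w (Adj-sym e ∷ acc)

    reverseOnto-len : ∀ {x y z} (w : Walk Adj x y) (acc : Walk Adj x z) →
                      len Adj (reverseOnto w acc) ≡ len Adj w + len Adj acc
    reverseOnto-len []      acc = refl
    reverseOnto-len (e ∷ w) acc = trans (reverseOnto-len w (Adj-sym e ∷ acc)) (+-suc _ _)

    -- x is an inner vertex of reverseOnto w acc exactly when both w and acc are nonempty.
    reverseOnto-inner : ∀ {P : V → Set} {x y z} (w : Walk Adj x y) (acc : Walk Adj x z) →
                        All P (inner Adj w) → All P (inner Adj acc) → (NonEmpty w → NonEmpty acc → P x) →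
                        All P (inner Adj (reverseOnto w acc))
    reverseOnto-inner []      acc _  pa _  = pa
    reverseOnto-inner (e ∷ w) acc pw pa px =
      reverseOnto-inner w (Adj-sym e ∷ acc) (inner-tail e w pw) (inner-cons (Adj-sym e) acc (px tt) pa)
        (λ ne _ → inner-head e w pw ne)

    reverse : ∀ {x y} → Walk Adj x y → Walk Adj y x
    reverse w = reverseOnto w []

    reverse-len : ∀ {x y} (w : Walk Adj x y) → len Adj (reverse w) ≡ len Adj w
    reverse-len w = trans (reverseOnto-len w []) (+-identityʳ _)

    reverse-isGeodesic : ∀ {x y} {w : Walk Adj x y} → IsGeodesic Adj w → IsGeodesic Adj (reverse w)
    reverse-isGeodesic {w = w} geo w′ =
      subst₂ _≤_ (sym (reverse-len w)) (reverse-len w′) (geo (reverse w′))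

    visible-sym : ∀ {X x y} → Visible Adj X x y → Visible Adj X y x
    visible-sym (w , geo , avoid) =
      reverse w , reverse-isGeodesic geo , reverseOnto-inner w [] avoid [] (λ _ ())

module _ {n : ℕ} where

  ChainBelow : (Fin n → Set) → ℕ → ℕ → Set
  ChainBelow X zero    m = ⊤
  ChainBelow X (suc j) m = Σ (Fin n) λ v → toℕ v < m × X v × ChainBelow X j (toℕ v)

  ChainBelow-mono : ∀ {X} j {m m′} → m ≤ m′ → ChainBelow X j m → ChainBelow X j m′
  ChainBelow-mono zero    _    _                  = tt
  ChainBelow-mono (suc j) m≤m′ (v , v<m , Xv , ch) = v , <-≤-trans v<m m≤m′ , Xv , ch

module _ {n k : ℕ} (c : Fin n → Fin k) where

  private
    indicator : Fin k → ℕ → ℕ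
    indicator i m with m <? n
    ... | no  _   = 0
    ... | yes m<n with c (fromℕ< m<n) ≟ᶠ i
    ...   | yes _ = 1
    ...   | no  _ = 0

    indicator-spec : ∀ i {m} (m<n : m < n) →
                     (c (fromℕ< m<n) ≡ i × indicator i m ≡ 1) ⊎ (c (fromℕ< m<n) ≢ i × indicator i m ≡ 0)
    indicator-spec i {m} m<n with m <? n
    ... | no  m≮n = ⊥-elim (m≮n m<n)
    ... | yes _ with c (fromℕ< m<n) ≟ᶠ i
    ...   | yes e  = inj₁ (e , refl)
    ...   | no  ¬e = inj₂ (¬e , refl)

    count : Fin k → ℕ → ℕ
    count i zero    = 0
    count i (suc m) = indicator i m + count i m

    chain-from-count : ∀ i m j → m ≤ n → j ≤ count i m → ChainBelow (λ v → c v ≡ i) j m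
    chain-from-count i zero    zero _   _ = tt
    chain-from-count i (suc m) j    m<n j≤count with indicator-spec i m<n
    ... | inj₁ (cv≡i , one) = chain j (subst (λ t → j ≤ t + count i m) one j≤count)
      where
      v≡m : toℕ (fromℕ< m<n) ≡ m
      v≡m = toℕ-fromℕ< m<n
      chain : ∀ j → j ≤ suc (count i m) → ChainBelow (λ v → c v ≡ i) j (suc m)
      chain zero     _  = tt
      chain (suc j′) j≤ = fromℕ< m<n , s≤s (≤-reflexive v≡m) , cv≡i ,
        subst (ChainBelow _ j′) (sym v≡m) (chain-from-count i m j′ (<⇒≤ m<n) (s≤s⁻¹ j≤))
    ... | inj₂ (_ , none) = ChainBelow-mono j (n≤1+n m)
      (chain-from-count i m j (<⇒≤ m<n) (subst (λ t → j ≤ t + count i m) none j≤count))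

    count-mono : ∀ i m d → count i m ≤ count i (d + m)
    count-mono i m zero    = ≤-refl
    count-mono i m (suc d) = ≤-trans (count-mono i m d) (m≤n+m _ _)

    count-suc : ∀ i (v : Fin n) → c v ≡ i → count i (suc (toℕ v)) ≡ suc (count i (toℕ v))
    count-suc i v cv≡i with indicator-spec i (toℕ<n v)
    ... | inj₁ (_ , one)  = cong (_+ count i (toℕ v)) one
    ... | inj₂ (cv≢i , _) = ⊥-elim (cv≢i (trans (cong c (fromℕ<-toℕ v (toℕ<n v))) cv≡i))

  -- v ↦ (colour of v, rank of v within its colour class) is injective.
  colourClasses-bound : ∀ r → (∀ i → ¬ ChainBelow (λ v → c v ≡ i) (suc r) n) → n ≤ k * r
  colourClasses-bound r noChain = injective⇒≤ code-injective
    where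
    rank : Fin n → ℕ
    rank v = count (c v) (toℕ v)

    rank< : ∀ v → rank v < r
    rank< v with rank v <? r
    ... | yes rank<r = rank<r
    ... | no  rank≮r = ⊥-elim (noChain (c v) (ChainBelow-mono (suc r) (toℕ<n v)
            (v , ≤-refl , refl , chain-from-count (c v) (toℕ v) r (<⇒≤ (toℕ<n v)) (≮⇒≥ rank≮r))))

    rank-increasing : ∀ u v → c u ≡ c v → toℕ u < toℕ v → rank u < rank v
    rank-increasing u v cu≡cv u<v = begin-strict
      count (c u) (toℕ u)                                  <⟨ n<1+n _ ⟩
      suc (count (c u) (toℕ u))                            ≡⟨ count-suc (c u) u refl ⟨
      count (c u) (suc (toℕ u))                            ≤⟨ count-mono (c u) (suc (toℕ u)) (toℕ v ∸ suc (toℕ u)) ⟩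
      count (c u) (toℕ v ∸ suc (toℕ u) + suc (toℕ u))      ≡⟨ cong (count (c u)) (m∸n+n≡m u<v) ⟩
      count (c u) (toℕ v)                                  ≡⟨ cong (λ i → count i (toℕ v)) cu≡cv ⟩
      count (c v) (toℕ v)                                  ∎
      where open ≤-Reasoning

    code : Fin n → Fin (k * r)
    code v = combine (c v) (fromℕ< (rank< v))

    code-injective : ∀ {u v} → code u ≡ code v → u ≡ v
    code-injective {u} {v} eq = toℕ-injective (≤-antisym
      (≮⇒≥ λ v<u → <-irrefl (sym rank≡) (rank-increasing v u (sym cu≡cv) v<u))
      (≮⇒≥ λ u<v → <-irrefl rank≡ (rank-increasing u v cu≡cv u<v)))
      where
      cu≡cv : c u ≡ c v
      cu≡cv = proj₁ (combine-injective (c u) _ (c v) _ eq)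
      rank≡ : rank u ≡ rank v
      rank≡ = trans (sym (toℕ-fromℕ< (rank< u)))
                    (trans (cong toℕ (proj₂ (combine-injective (c u) _ (c v) _ eq))) (toℕ-fromℕ< (rank< v)))

module Cycle (n : ℕ) where

  Adj : Fin n → Fin n → Set
  Adj = CycleAdj n

  Adj-sym : ∀ {x y} → Adj x y → Adj y x
  Adj-sym (inj₁ e)               = inj₂ (inj₁ e)
  Adj-sym (inj₂ (inj₁ e))        = inj₁ e
  Adj-sym (inj₂ (inj₂ (inj₁ e))) = inj₂ (inj₂ (inj₂ e))
  Adj-sym (inj₂ (inj₂ (inj₂ e))) = inj₂ (inj₂ (inj₁ e))

  Adj-irrefl : 2 ≤ n → ∀ {x} → ¬ Adj x x
  Adj-irrefl _   (inj₁ e)                      = <⇒≢ (n<1+n _) e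
  Adj-irrefl _   (inj₂ (inj₁ e))               = <⇒≢ (n<1+n _) e
  Adj-irrefl 2≤n (inj₂ (inj₂ (inj₁ (x≡0 , e)))) = <⇒≱ 2≤n (≤-reflexive (trans (sym e) (cong suc x≡0)))
  Adj-irrefl 2≤n (inj₂ (inj₂ (inj₂ (x≡0 , e)))) = <⇒≱ 2≤n (≤-reflexive (trans (sym e) (cong suc x≡0)))

  Clockwise : ℕ → ℕ → ℕ → Set
  Clockwise p j q = q ≡ p + j ⊎ q + n ≡ p + j

  -- p and q are at most L apart: directly, or across the edge between n - 1 and 0 in either direction.
  DistAtMost : ℕ → ℕ → ℕ → Set
  DistAtMost p q L = (p ≤ q + L × q ≤ p + L) ⊎ (n + q ≤ L + p) ⊎ (n + p ≤ L + q)

  open ≤-Reasoning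

  private
    dist-pred : ∀ p q L → DistAtMost (suc p) q L → DistAtMost p q (suc L)
    dist-pred p q L (inj₁ (a , b)) =
      inj₁ (≤-trans (n≤1+n p) (≤-trans a (+-monoʳ-≤ q (n≤1+n L))) , subst (q ≤_) (sym (+-suc p L)) b)
    dist-pred p q L (inj₂ (inj₁ c)) = inj₂ (inj₁ (subst (n + q ≤_) (+-suc L p) c))
    dist-pred p q L (inj₂ (inj₂ d)) = inj₂ (inj₂ (≤-trans (+-monoʳ-≤ n (n≤1+n p)) (≤-trans d (n≤1+n _))))

    dist-suc : ∀ p q L → DistAtMost p q L → DistAtMost (suc p) q (suc L)
    dist-suc p q L (inj₁ (a , b)) =
      inj₁ (subst (suc p ≤_) (sym (+-suc q L)) (s≤s a) , ≤-trans b (≤-trans (n≤1+n _) (s≤s (+-monoʳ-≤ p (n≤1+n L)))))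
    dist-suc p q L (inj₂ (inj₁ c)) = inj₂ (inj₁ (≤-trans c (+-mono-≤ (n≤1+n L) (n≤1+n p))))
    dist-suc p q L (inj₂ (inj₂ d)) = inj₂ (inj₂ (subst (_≤ suc L + q) (sym (+-suc n p)) (s≤s d)))

    dist-wrap-up : ∀ v q L → suc v ≡ n → DistAtMost v q L → DistAtMost 0 q (suc L)
    dist-wrap-up v q L e (inj₁ (a , _)) = inj₂ (inj₂ (begin
      n + 0        ≡⟨ +-identityʳ n ⟩
      n            ≡⟨ sym e ⟩
      suc v        ≤⟨ s≤s a ⟩
      suc (q + L)  ≡⟨ cong suc (+-comm q L) ⟩
      suc L + q    ∎))
    dist-wrap-up v q L e (inj₂ (inj₁ c)) = inj₁ (z≤n , ≤-trans (+-cancelʳ-≤ n q L (begin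
      q + n  ≡⟨ +-comm q n ⟩
      n + q  ≤⟨ c ⟩
      L + v  ≤⟨ +-monoʳ-≤ L (≤-trans (n≤1+n v) (≤-reflexive e)) ⟩
      L + n  ∎)) (n≤1+n L))
    dist-wrap-up v q L e (inj₂ (inj₂ d)) = inj₂ (inj₂ (≤-trans (+-monoʳ-≤ n z≤n) (≤-trans d (n≤1+n _))))

    dist-wrap-down : ∀ u q L → q < n → suc u ≡ n → DistAtMost 0 q L → DistAtMost u q (suc L)
    dist-wrap-down u q L q<n e (inj₁ (_ , b)) = inj₂ (inj₁ (begin
      n + q      ≡⟨ cong (_+ q) (sym e) ⟩
      suc u + q  ≤⟨ +-monoʳ-≤ (suc u) b ⟩
      suc (u + L) ≡⟨ cong suc (+-comm u L) ⟩
      suc L + u  ∎))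
    dist-wrap-down u q L q<n e (inj₂ (inj₁ c)) = inj₂ (inj₁ (≤-trans c (+-mono-≤ (n≤1+n L) z≤n)))
    dist-wrap-down u q L q<n e (inj₂ (inj₂ d)) = inj₁ (u≤q+1+L , ≤-trans (s≤s⁻¹ (≤-trans q<n (≤-reflexive (sym e)))) (m≤m+n u (suc L)))
      where
      u≤q+1+L : u ≤ q + suc L
      u≤q+1+L = begin
        u          ≤⟨ n≤1+n u ⟩
        suc u      ≡⟨ e ⟩
        n          ≡⟨ sym (+-identityʳ n) ⟩
        n + 0      ≤⟨ d ⟩
        L + q      ≡⟨ +-comm L q ⟩
        q + L      ≤⟨ +-monoʳ-≤ q (n≤1+n L) ⟩
        q + suc L  ∎

  DistAtMost-step : ∀ {u v : Fin n} q L → q < n → Adj u v → DistAtMost (toℕ v) q L → DistAtMost (toℕ u) q (suc L)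
  DistAtMost-step {u} q L _   (inj₁ e) d =
    dist-pred (toℕ u) q L (subst (λ t → DistAtMost t q L) e d)
  DistAtMost-step {v = v} q L _   (inj₂ (inj₁ e)) d =
    subst (λ t → DistAtMost t q (suc L)) (sym e) (dist-suc (toℕ v) q L d)
  DistAtMost-step {v = v} q L _   (inj₂ (inj₂ (inj₁ (u≡0 , e)))) d =
    subst (λ t → DistAtMost t q (suc L)) (sym u≡0) (dist-wrap-up (toℕ v) q L e d)
  DistAtMost-step {u} q L q<n (inj₂ (inj₂ (inj₂ (v≡0 , e)))) d =
    dist-wrap-down (toℕ u) q L q<n e (subst (λ t → DistAtMost t q L) v≡0 d)

  walk-DistAtMost : ∀ {x y : Fin n} (w : Walk Adj x y) → DistAtMost (toℕ x) (toℕ y) (len Adj w)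
  walk-DistAtMost []      = inj₁ (m≤m+n _ 0 , m≤m+n _ 0)
  walk-DistAtMost {y = y} (e ∷ w) = DistAtMost-step (toℕ y) _ (toℕ<n y) e (walk-DistAtMost w)

  private
    cancel-via : ∀ p a b {x y} → x ≤ y → x ≡ p + a → y ≡ p + b → a ≤ b
    cancel-via p a b x≤y refl refl = +-cancelˡ-≤ p a b x≤y

    half≤ : ∀ {m} → m + m ≤ n → m ≤ n
    half≤ {m} m+m≤n = ≤-trans (m≤m+n m m) m+m≤n

  -- Going the other way round costs n - m, which is at least m.
  clockwise-DistAtMost : ∀ p q m L → m + m ≤ n → Clockwise p m q → DistAtMost p q L → m ≤ L
  clockwise-DistAtMost p q m L m+m≤n (inj₁ e) (inj₁ (_ , b)) = cancel-via p m L b e refl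
  clockwise-DistAtMost p q m L m+m≤n (inj₁ e) (inj₂ (inj₁ c)) = cancel-via p m L (≤-trans (m≤n+m q n) c) e (+-comm L p)
  clockwise-DistAtMost p q m L m+m≤n (inj₁ e) (inj₂ (inj₂ d)) =
    +-cancelʳ-≤ m m L (cancel-via p (m + m) (L + m) (≤-trans (+-monoˡ-≤ p m+m≤n) d) (+-comm (m + m) p)
      (trans (cong (L +_) e) (swap L p m)))
    where
    swap : ∀ L p m → L + (p + m) ≡ p + (L + m)
    swap = solve-∀
  clockwise-DistAtMost p q m L m+m≤n (inj₂ e) (inj₁ (a , _)) =
    +-cancelˡ-≤ m m L (≤-trans m+m≤n (cancel-via p n (m + L) (+-monoˡ-≤ n a) refl
      (trans (swap q L n) (trans (cong (_+ L) e) (+-assoc p m L)))))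
    where
    swap : ∀ q L n → q + L + n ≡ q + n + L
    swap = solve-∀
  clockwise-DistAtMost p q m L m+m≤n (inj₂ e) (inj₂ (inj₁ c)) = cancel-via p m L c (trans (+-comm n q) e) (+-comm L p)
  clockwise-DistAtMost p q m L m+m≤n (inj₂ e) (inj₂ (inj₂ d)) =
    ≤-trans (half≤ m+m≤n) (+-cancelʳ-≤ n n L (≤-trans
      (cancel-via p (n + n) (L + m) (+-monoˡ-≤ n d) (swap₁ n p) (trans (+-assoc L q n) (trans (cong (L +_) e) (swap₂ L p m))))
      (+-monoʳ-≤ L (half≤ m+m≤n))))
    where
    swap₁ : ∀ n p → n + p + n ≡ p + (n + n)
    swap₁ = solve-∀
    swap₂ : ∀ L p m → L + (p + m) ≡ p + (L + m)
    swap₂ = solve-∀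

  walk-len-≥ : ∀ {x y : Fin n} {m} → m + m ≤ n → Clockwise (toℕ x) m (toℕ y) → (w : Walk Adj x y) → m ≤ len Adj w
  walk-len-≥ {x} {y} m+m≤n cw w = clockwise-DistAtMost (toℕ x) (toℕ y) _ (len Adj w) m+m≤n cw (walk-DistAtMost w)

  Clockwise-suc : ∀ {a j z u} → a < n → j < n → Clockwise a 1 z → Clockwise z j u → Clockwise a (suc j) u
  Clockwise-suc {a} {j} _ _ (inj₁ refl) (inj₁ refl) = inj₁ (+-assoc a 1 j)
  Clockwise-suc {a} {j} _ _ (inj₁ refl) (inj₂ e)    = inj₂ (trans e (+-assoc a 1 j))
  Clockwise-suc {a} {j} {z} _ _ (inj₂ e) (inj₁ refl) = inj₂ (begin-equality
    z + j + n  ≡⟨ +-assoc z j n ⟩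
    z + (j + n) ≡⟨ cong (z +_) (+-comm j n) ⟩
    z + (n + j) ≡⟨ sym (+-assoc z n j) ⟩
    z + n + j  ≡⟨ cong (_+ j) e ⟩
    a + 1 + j  ≡⟨ +-assoc a 1 j ⟩
    a + suc j  ∎)
  Clockwise-suc {a} {j} {z} {u} a<n j<n (inj₂ e₁) (inj₂ e₂) = ⊥-elim (<⇒≱ j<n (begin
    n          ≤⟨ m≤n+m n u ⟩
    u + n      ≡⟨ e₂ ⟩
    z + j      ≡⟨ cong (_+ j) z≡0 ⟩
    j          ∎))
    where
    z≡0 : z ≡ 0
    z≡0 = n≤0⇒n≡0 (+-cancelʳ-≤ n z 0 (begin
      z + n  ≡⟨ e₁ ⟩
      a + 1  ≡⟨ +-comm a 1 ⟩
      suc a  ≤⟨ a<n ⟩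
      n      ∎))

  Clockwise-unique : ∀ {a m y z} → y < n → z < n → Clockwise a m y → Clockwise a m z → y ≡ z
  Clockwise-unique _   _   (inj₁ e₁) (inj₁ e₂) = trans e₁ (sym e₂)
  Clockwise-unique _   _   (inj₂ e₁) (inj₂ e₂) = +-cancelʳ-≡ n _ _ (trans e₁ (sym e₂))
  Clockwise-unique {y = y} {z} y<n _ (inj₁ e₁) (inj₂ e₂) =
    ⊥-elim (<⇒≱ y<n (≤-trans (m≤n+m n z) (≤-reflexive (trans e₂ (sym e₁)))))
  Clockwise-unique {y = y} {z} _ z<n (inj₂ e₁) (inj₁ e₂) =
    ⊥-elim (<⇒≱ z<n (≤-trans (m≤n+m n y) (≤-reflexive (trans e₁ (sym e₂)))))

  Clockwise-no-wrap : ∀ {p j m q u} → j < m → q ≡ p + m → q < n → Clockwise p j u → u ≡ p + j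
  Clockwise-no-wrap _ _ _ (inj₁ e) = e
  Clockwise-no-wrap {p} {j} {m} {q} {u} j<m q≡ q<n (inj₂ e) = ⊥-elim (<⇒≱ p+j<n (begin
    n      ≤⟨ m≤n+m n u ⟩
    u + n  ≡⟨ e ⟩
    p + j  ∎))
    where
    p+j<n : p + j < n
    p+j<n = begin-strict
      p + j  <⟨ +-monoʳ-< p j<m ⟩
      p + m  ≡⟨ sym q≡ ⟩
      q      <⟨ q<n ⟩
      n      ∎

  next : Fin n → Fin n
  next v with suc (toℕ v) <? n
  ... | yes v+1<n = fromℕ< v+1<n
  ... | no  _     = fromℕ< {0} (≤-trans (s≤s z≤n) (toℕ<n v))

  private
    next-spec : ∀ v → toℕ (next v) ≡ suc (toℕ v) ⊎ (toℕ (next v) ≡ 0 × suc (toℕ v) ≡ n)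
    next-spec v with suc (toℕ v) <? n
    ... | yes v+1<n = inj₁ (toℕ-fromℕ< v+1<n)
    ... | no  v+1≮n = inj₂ (toℕ-fromℕ< {0} _ , ≤-antisym (toℕ<n v) (≮⇒≥ v+1≮n))

  next-adj : ∀ v → Adj v (next v)
  next-adj v with next-spec v
  ... | inj₁ e = inj₁ e
  ... | inj₂ e = inj₂ (inj₂ (inj₂ e))

  next-clockwise : ∀ v → Clockwise (toℕ v) 1 (toℕ (next v))
  next-clockwise v with next-spec v
  ... | inj₁ e        = inj₁ (trans e (+-comm 1 (toℕ v)))
  ... | inj₂ (e₀ , e) = inj₂ (trans (cong (_+ n) e₀) (trans (sym e) (+-comm 1 (toℕ v))))

  AllInArc : (Fin n → Set) → Fin n → ℕ → Set
  AllInArc P x m = ∀ {j} → j < m → 0 < j → ∀ u → Clockwise (toℕ x) j (toℕ u) → P u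

  ArcWalk : (Fin n → Set) → Fin n → ℕ → Set
  ArcWalk P x m = Σ (Fin n) λ y → Clockwise (toℕ x) m (toℕ y) ×
                  Σ (Walk Adj x y) λ w → len Adj w ≡ m × All P (inner Adj w)

  private
    nonEmpty-len : ∀ {x y} (w : Walk Adj x y) → NonEmpty w → 0 < len Adj w
    nonEmpty-len (_ ∷ _) _ = s≤s z≤n

  arcWalk : ∀ {P} x m → m ≤ n → AllInArc P x m → ArcWalk P x m
  arcWalk x zero    _   _     = x , inj₁ (sym (+-identityʳ _)) , [] , refl , []
  arcWalk {P} x (suc m) m<n inArc = extend (arcWalk (next x) m (<⇒≤ m<n) inArc-next)
    where
    inArc-next : AllInArc P (next x) m
    inArc-next j<m _ u cw =
      inArc (s≤s j<m) (s≤s z≤n) u (Clockwise-suc (toℕ<n x) (<-trans j<m m<n) (next-clockwise x) cw)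
    extend : ArcWalk P (next x) m → ArcWalk P x (suc m)
    extend (y , cw , w , len≡m , pw) =
      y , Clockwise-suc (toℕ<n x) m<n (next-clockwise x) cw , next-adj x ∷ w , cong suc len≡m ,
      inner-cons (next-adj x) w (λ ne → inArc (s≤s (subst (0 <_) len≡m (nonEmpty-len w ne))) (s≤s z≤n) (next x) (next-clockwise x)) pw

  ShortArc : (Fin n → Set) → Fin n → Fin n → ℕ → Set
  ShortArc X x y m = m + m ≤ n × Clockwise (toℕ x) m (toℕ y) × AllInArc (λ u → ¬ X u) x m

  shortArc-len : ∀ {X x y m} → ShortArc X x y m → (w : Walk Adj x y) → m ≤ len Adj w
  shortArc-len (m+m≤n , cw , _) = walk-len-≥ m+m≤n cw

  shortArc⇒visible : ∀ {X x y m} → ShortArc X x y m → Visible Adj X x y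
  shortArc⇒visible {X} {x} {y} {m} arc@(m+m≤n , cw , avoid) with arcWalk x m (half≤ m+m≤n) avoid
  ... | z , cwz , w , refl , pw with toℕ-injective (Clockwise-unique {toℕ x} {m} (toℕ<n z) (toℕ<n y) cwz cw)
  ... | refl = w , shortArc-len arc , pw

  ArcJoined : (Fin n → Set) → ℕ → Fin n → Fin n → Set
  ArcJoined X lo x y = x ≡ y ⊎ (∃ λ m → lo ≤ m × ShortArc X x y m) ⊎ (∃ λ m → lo ≤ m × ShortArc X y x m)

  ArcCondition : (Fin n → Set) → ℕ → Set
  ArcCondition X lo = ∀ x y → X x → X y → ArcJoined X lo x y

  arcCondition⇒IsMV : ∀ {X lo} → ArcCondition X lo → IsMV Adj X
  arcCondition⇒IsMV ac x y Xx Xy with ac x y Xx Xy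
  ... | inj₁ refl                = [] , (λ _ → z≤n) , []
  ... | inj₂ (inj₁ (_ , _ , arc)) = shortArc⇒visible arc
  ... | inj₂ (inj₂ (_ , _ , arc)) = visible-sym Adj-sym (shortArc⇒visible arc)

  arcCondition⇒IsIMV : ∀ {X} → 2 ≤ n → ArcCondition X 2 → IsIMV Adj X
  arcCondition⇒IsIMV {X} 2≤n ac = independent , arcCondition⇒IsMV ac
    where
    independent : IsIndependent Adj X
    independent x y Xx Xy xy with ac x y Xx Xy
    ... | inj₁ refl                  = Adj-irrefl 2≤n xy
    ... | inj₂ (inj₁ (_ , 2≤m , arc)) = <⇒≱ 2≤m (shortArc-len arc (xy ∷ []))
    ... | inj₂ (inj₂ (_ , 2≤m , arc)) = <⇒≱ 2≤m (shortArc-len arc (Adj-sym xy ∷ []))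

  module _ (X : Fin n → Set) {b d : Fin n} (Xb : X b) (Xd : X d) where

    private
      Inside Avoids : Fin n → Set
      Inside v = toℕ b < toℕ v × toℕ v < toℕ d
      Avoids v = toℕ v ≢ toℕ b × toℕ v ≢ toℕ d

      ¬X⇒avoids : ∀ {v} → ¬ X v → Avoids v
      ¬X⇒avoids ¬Xv = (λ e → ¬Xv (subst X (toℕ-injective (sym e)) Xb)) , (λ e → ¬Xv (subst X (toℕ-injective (sym e)) Xd))

      inside-step : ∀ {u v} → Adj u v → Avoids u → Inside v → Inside u
      inside-step (inj₁ e) (u≢b , _) (b<v , v<d) =
        ≤∧≢⇒< (s≤s⁻¹ (subst (toℕ b <_) e b<v)) (u≢b ∘ sym) , <-trans (n<1+n _) (subst (_< toℕ d) e v<d)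
      inside-step (inj₂ (inj₁ e)) (_ , u≢d) (b<v , v<d) =
        <-trans b<v (subst (_ <_) (sym e) (n<1+n _)) , ≤∧≢⇒< (subst (_≤ toℕ d) (sym e) v<d) u≢d
      inside-step (inj₂ (inj₂ (inj₁ (_ , e)))) _ (_ , v<d) =
        ⊥-elim (<⇒≱ v<d (s≤s⁻¹ (subst (toℕ d <_) (sym e) (toℕ<n d))))
      inside-step (inj₂ (inj₂ (inj₂ (v≡0 , _)))) _ (b<v , _) =
        ⊥-elim (<⇒≱ (subst (toℕ b <_) v≡0 b<v) z≤n)

      -- A walk whose inner vertices avoid X can only cross into the interval (b, d) at b or d.
      inside-walk : ∀ {u y} (w : Walk Adj u y) → Avoids u → Avoids y → All (λ v → ¬ X v) (inner Adj w) →
                    Inside y → Inside u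
      inside-walk []                   _  _  _           iy = iy
      inside-walk (e ∷ [])             au _  _           iy = inside-step e au iy
      inside-walk (e ∷ w@(_ ∷ _)) au ay (¬Xv ∷ pw) iy = inside-step e au (inside-walk w (¬X⇒avoids ¬Xv) ay pw iy)

    isMV-no-four : IsMV Adj X → ∀ {a c} → toℕ a < toℕ b → toℕ b < toℕ c → toℕ c < toℕ d → X a → X c → ⊥
    isMV-no-four mv {a} {c} a<b b<c c<d Xa Xc with mv a c Xa Xc
    ... | w , _ , avoid =
      <⇒≱ a<b (<⇒≤ (proj₁ (inside-walk w (<⇒≢ a<b , <⇒≢ (<-trans a<b b<d)) (>⇒≢ b<c , <⇒≢ c<d) avoid (b<c , c<d))))
      where
      b<d : toℕ b < toℕ d
      b<d = <-trans b<c c<d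

  isMV-noChain : ∀ {X} → IsMV Adj X → ¬ ChainBelow X 4 n
  isMV-noChain {X} mv (d , _ , Xd , c , c<d , Xc , b , b<c , Xb , a , a<b , Xa , _) =
    isMV-no-four X Xb Xd mv a<b b<c c<d Xa Xc

  mvPartition-bound : ∀ {k} → MVPartition Adj k → n ≤ k * 3
  mvPartition-bound (c , mv) = colourClasses-bound c 3 (λ i → isMV-noChain (mv i))

  singletonPartition : 2 ≤ n → IMVPartition Adj n
  singletonPartition 2≤n = (λ v → v) , λ i → arcCondition⇒IsIMV 2≤n (λ x y x≡i y≡i → inj₁ (trans x≡i (sym y≡i)))

  Adj? : ∀ x y → Dec (Adj x y)
  Adj? x y = toℕ y ≟ suc (toℕ x) ⊎-dec toℕ x ≟ suc (toℕ y)
             ⊎-dec (toℕ x ≟ 0 ×-dec suc (toℕ y) ≟ n) ⊎-dec (toℕ y ≟ 0 ×-dec suc (toℕ x) ≟ n)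

  module _ {X : Fin n → Set} (X? : ∀ v → Dec (X v)) where

    BoundedArcJoined : ℕ → Fin n → Fin n → Set
    BoundedArcJoined lo x y = x ≡ y ⊎ (∃ λ m → m < n × lo ≤ m × ShortArc X x y m)
                                    ⊎ (∃ λ m → m < n × lo ≤ m × ShortArc X y x m)

    private
      Clockwise? : ∀ p j q → Dec (Clockwise p j q)
      Clockwise? p j q = q ≟ p + j ⊎-dec q + n ≟ p + j

      shortArc? : ∀ x y m → Dec (ShortArc X x y m)
      shortArc? x y m = m + m ≤? n ×-dec Clockwise? (toℕ x) m (toℕ y)
        ×-dec allUpTo? (λ j → 0 <? j →-dec all? λ u → Clockwise? (toℕ x) j (toℕ u) →-dec ¬? (X? u)) m

      boundedArcJoined? : ∀ lo x y → Dec (BoundedArcJoined lo x y)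
      boundedArcJoined? lo x y = x ≟ᶠ y
        ⊎-dec anyUpTo? (λ m → lo ≤? m ×-dec shortArc? x y m) n
        ⊎-dec anyUpTo? (λ m → lo ≤? m ×-dec shortArc? y x m) n

      forget-bound : ∀ {lo x y} → BoundedArcJoined lo x y → ArcJoined X lo x y
      forget-bound (inj₁ x≡y)                  = inj₁ x≡y
      forget-bound (inj₂ (inj₁ (m , _ , arc))) = inj₂ (inj₁ (m , arc))
      forget-bound (inj₂ (inj₂ (m , _ , arc))) = inj₂ (inj₂ (m , arc))

    arcCondition? : ∀ lo → Dec (∀ x y → X x → X y → BoundedArcJoined lo x y)
    arcCondition? lo = all? λ x → all? λ y → X? x →-dec X? y →-dec boundedArcJoined? lo x y

    arcCondition-bounded : ∀ {lo} → (∀ x y → X x → X y → BoundedArcJoined lo x y) → ArcCondition X lo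
    arcCondition-bounded ac x y Xx Xy = forget-bound (ac x y Xx Xy)

ceil3-least : ∀ {n k} → n ≤ k * 3 → ceil3 n ≤ k
ceil3-least {n} {k} n≤3k = s≤s⁻¹ (m<n*o⇒m/o<n {n + 2} {suc k} {3}
  (subst (_≤ 3 + k * 3) (trans (+-comm 3 n) (+-suc n 2)) (+-monoʳ-≤ 3 n≤3k)))

ceil3-+3 : ∀ n → ceil3 (3 + n) ≡ suc (ceil3 n)
ceil3-+3 n = m/n≡1+[m∸n]/n {3 + n + 2} {3} (s≤s (s≤s (s≤s z≤n)))

-- Colour i is used at i, i + k and i + k + d₁, so consecutive vertices of a colour class
-- are k, d₁ and d₂ apart around the cycle.
record BlockGaps (n : ℕ) : Set where
  field
    k d₁ d₂ : ℕ
    n≡k+d₁+d₂ : n ≡ k + d₁ + d₂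
    d₁≤k      : d₁ ≤ k
    k≤1+d₁    : k ≤ suc d₁
    d₂≤k      : d₂ ≤ k
    0<d₁      : 0 < d₁
    0<d₂      : 0 < d₂

module BlockColouring {n : ℕ} (g : BlockGaps n) where
  open BlockGaps g
  open Cycle n
  open ≤-Reasoning

  K₂ : ℕ
  K₂ = k + d₁

  private
    n≡K₂+d₂ : n ≡ K₂ + d₂
    n≡K₂+d₂ = n≡k+d₁+d₂

    k+k≤n : k + k ≤ n
    k+k≤n = begin
      k + k        ≤⟨ +-monoʳ-≤ k k≤1+d₁ ⟩
      k + suc d₁   ≡⟨ cong (k +_) (+-comm 1 d₁) ⟩
      k + (d₁ + 1) ≤⟨ +-monoʳ-≤ k (+-monoʳ-≤ d₁ 0<d₂) ⟩
      k + (d₁ + d₂) ≡⟨ sym (+-assoc k d₁ d₂) ⟩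
      K₂ + d₂      ≡⟨ sym n≡K₂+d₂ ⟩
      n            ∎

    K₂≤k+k : K₂ ≤ k + k
    K₂≤k+k = +-monoʳ-≤ k d₁≤k

  colourℕ : ℕ → ℕ
  colourℕ v with v <? k
  ... | yes _ = v
  ... | no  _ with v <? k + k
  ...   | yes _ = v ∸ k
  ...   | no  _ = v ∸ K₂

  data Block (v c : ℕ) : Set where
    first  : v < k → c ≡ v → Block v c
    second : k ≤ v → v < k + k → c + k ≡ v → Block v c
    third  : k + k ≤ v → c + K₂ ≡ v → Block v c

  block : ∀ v → Block v (colourℕ v)
  block v with v <? k
  ... | yes v<k = first v<k refl
  ... | no  v≮k with v <? k + k
  ...   | yes v<k+k = second (≮⇒≥ v≮k) v<k+k (m∸n+n≡m (≮⇒≥ v≮k))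
  ...   | no  v≮k+k = third (≮⇒≥ v≮k+k) (m∸n+n≡m (≤-trans K₂≤k+k (≮⇒≥ v≮k+k)))

  colourℕ< : ∀ {v} → v < n → colourℕ v < k
  colourℕ< {v} v<n with colourℕ v | block v
  ... | c | first v<k e      = subst (_< k) (sym e) v<k
  ... | c | second _ v<k+k e = +-cancelʳ-< k c k (subst (_< k + k) (sym e) v<k+k)
  ... | c | third _ e        = <-≤-trans (+-cancelˡ-< K₂ c d₂ (begin-strict
    K₂ + c  ≡⟨ +-comm K₂ c ⟩
    c + K₂  ≡⟨ e ⟩
    v               <⟨ v<n ⟩
    n               ≡⟨ n≡K₂+d₂ ⟩
    K₂ + d₂         ∎)) d₂≤k

  colour : Fin n → Fin k
  colour v = fromℕ< (colourℕ< (toℕ<n v))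

  module ColourClass (i : Fin k) where

    t : ℕ
    t = toℕ i

    X : Fin n → Set
    X v = colour v ≡ i

    private
      block-of : ∀ {v} → X v → Block (toℕ v) t
      block-of {v} Xv = subst (Block (toℕ v)) (trans (sym (toℕ-fromℕ< _)) (cong toℕ Xv)) (block (toℕ v))

      arc₀₁ : ∀ {x y} → toℕ x ≡ t → toℕ y ≡ t + k → ShortArc X x y k
      arc₀₁ {x} {y} x≡ y≡ = k+k≤n , inj₁ y≡x+k , avoid
        where
        y≡x+k : toℕ y ≡ toℕ x + k
        y≡x+k = trans y≡ (cong (_+ k) (sym x≡))
        avoid : AllInArc (λ u → ¬ X u) x k
        avoid {j} j<k 0<j u cw Xu = impossible (block-of Xu)
          where
          u≡ : toℕ u ≡ t + j
          u≡ = trans (Clockwise-no-wrap j<k y≡x+k (toℕ<n y) cw) (cong (_+ j) x≡)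
          impossible : Block (toℕ u) t → ⊥
          impossible (first _ t≡u)  = <⇒≢ (m<m+n t 0<j) (trans t≡u u≡)
          impossible (second _ _ e) = <⇒≢ j<k (sym (+-cancelˡ-≡ t k j (trans e u≡)))
          impossible (third k+k≤u _) = <⇒≱ (+-mono-< (toℕ<n i) j<k) (subst (k + k ≤_) u≡ k+k≤u)

      arc₁₂ : ∀ {x y} → toℕ x ≡ t + k → toℕ y ≡ t + K₂ → ShortArc X x y d₁
      arc₁₂ {x} {y} x≡ y≡ = ≤-trans (+-mono-≤ d₁≤k d₁≤k) k+k≤n , inj₁ y≡x+d₁ , avoid
        where
        y≡x+d₁ : toℕ y ≡ toℕ x + d₁
        y≡x+d₁ = trans y≡ (trans (sym (+-assoc t k d₁)) (cong (_+ d₁) (sym x≡)))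
        avoid : AllInArc (λ u → ¬ X u) x d₁
        avoid {j} j<d₁ 0<j u cw Xu = impossible (block-of Xu)
          where
          u≡ : toℕ u ≡ t + k + j
          u≡ = trans (Clockwise-no-wrap j<d₁ y≡x+d₁ (toℕ<n y) cw) (cong (_+ j) x≡)
          impossible : Block (toℕ u) t → ⊥
          impossible (first u<k _)  = <⇒≱ u<k (begin
            k          ≤⟨ m≤n+m k t ⟩
            t + k      ≤⟨ m≤m+n (t + k) j ⟩
            t + k + j  ≡⟨ sym u≡ ⟩
            toℕ u      ∎)
          impossible (second _ _ e) = <⇒≢ (m<m+n (t + k) 0<j) (trans e u≡)
          impossible (third _ e)    = <⇒≢ j<d₁ (sym (+-cancelˡ-≡ (t + k) d₁ j (trans (+-assoc t k d₁) (trans e u≡))))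

      arc₂₀ : ∀ {x y} → toℕ x ≡ t + K₂ → toℕ y ≡ t → ShortArc X x y d₂
      arc₂₀ {x} {y} x≡ y≡ = ≤-trans (+-mono-≤ d₂≤k d₂≤k) k+k≤n , inj₂ y+n≡x+d₂ , avoid
        where
        y+n≡x+d₂ : toℕ y + n ≡ toℕ x + d₂
        y+n≡x+d₂ = begin-equality
          toℕ y + n      ≡⟨ cong₂ _+_ y≡ n≡K₂+d₂ ⟩
          t + (K₂ + d₂)  ≡⟨ sym (+-assoc t K₂ d₂) ⟩
          t + K₂ + d₂    ≡⟨ cong (_+ d₂) (sym x≡) ⟩
          toℕ x + d₂     ∎
        avoid : AllInArc (λ u → ¬ X u) x d₂
        avoid {j} j<d₂ 0<j u (inj₁ e) Xu = impossible (block-of Xu)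
          where
          u≡ : toℕ u ≡ t + K₂ + j
          u≡ = trans e (cong (_+ j) x≡)
          k+k≤u : k + k ≤ toℕ u
          k+k≤u = begin
            k + k         ≤⟨ +-monoʳ-≤ k k≤1+d₁ ⟩
            k + suc d₁    ≡⟨ +-suc k d₁ ⟩
            suc K₂        ≤⟨ s≤s (m≤n+m K₂ t) ⟩
            suc (t + K₂)  ≡⟨ +-comm 1 (t + K₂) ⟩
            t + K₂ + 1    ≤⟨ +-monoʳ-≤ (t + K₂) 0<j ⟩
            t + K₂ + j    ≡⟨ sym u≡ ⟩
            toℕ u         ∎
          impossible : Block (toℕ u) t → ⊥
          impossible (first u<k _)      = <⇒≱ u<k (≤-trans (m≤m+n k k) k+k≤u)
          impossible (second _ u<k+k _) = <⇒≱ u<k+k k+k≤u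
          impossible (third _ e)        = <⇒≢ (m<m+n (t + K₂) 0<j) (trans e u≡)
        avoid {j} j<d₂ 0<j u (inj₂ e) Xu = impossible (block-of Xu)
          where
          u<t : toℕ u < t
          u<t = +-cancelʳ-< n (toℕ u) t (begin-strict
            toℕ u + n      ≡⟨ e ⟩
            toℕ x + j      ≡⟨ cong (_+ j) x≡ ⟩
            t + K₂ + j     <⟨ +-monoʳ-< (t + K₂) j<d₂ ⟩
            t + K₂ + d₂    ≡⟨ +-assoc t K₂ d₂ ⟩
            t + (K₂ + d₂)  ≡⟨ cong (t +_) (sym n≡K₂+d₂) ⟩
            t + n          ∎)
          u<k : toℕ u < k
          u<k = <-trans u<t (toℕ<n i)
          impossible : Block (toℕ u) t → ⊥
          impossible (first _ t≡u)     = <⇒≢ u<t (sym t≡u)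
          impossible (second k≤u _ _)  = <⇒≱ u<k k≤u
          impossible (third k+k≤u _)   = <⇒≱ u<k (≤-trans (m≤m+n k k) k+k≤u)

      data Position (v : ℕ) : Set where
        at₀ : v ≡ t → Position v
        at₁ : v ≡ t + k → Position v
        at₂ : k + k ≤ v → v ≡ t + K₂ → Position v

      position : ∀ {v} → X v → Position (toℕ v)
      position Xv with block-of Xv
      ... | first _ e       = at₀ (sym e)
      ... | second _ _ e    = at₁ (sym e)
      ... | third k+k≤v e   = at₂ k+k≤v (sym e)

    arcCondition : ∀ {lo} → lo ≤ k → (k + k < n → lo ≤ d₁ × lo ≤ d₂) → ArcCondition X lo
    arcCondition {lo} lo≤k lo≤gaps x y Xx Xy = pair (position Xx) (position Xy)
      where
      wide : ∀ {v : Fin n} → k + k ≤ toℕ v → k + k < n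
      wide {v} k+k≤v = ≤-<-trans k+k≤v (toℕ<n v)
      same : ∀ {a} → toℕ x ≡ a → toℕ y ≡ a → ArcJoined X lo x y
      same ex ey = inj₁ (toℕ-injective (trans ex (sym ey)))
      pair : Position (toℕ x) → Position (toℕ y) → ArcJoined X lo x y
      pair (at₀ ex)   (at₀ ey)   = same ex ey
      pair (at₁ ex)   (at₁ ey)   = same ex ey
      pair (at₂ _ ex) (at₂ _ ey) = same ex ey
      pair (at₀ ex)   (at₁ ey)   = inj₂ (inj₁ (k , lo≤k , arc₀₁ ex ey))
      pair (at₁ ex)   (at₀ ey)   = inj₂ (inj₂ (k , lo≤k , arc₀₁ ey ex))
      pair (at₁ ex)   (at₂ w ey) = inj₂ (inj₁ (d₁ , proj₁ (lo≤gaps (wide w)) , arc₁₂ ex ey))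
      pair (at₂ w ex) (at₁ ey)   = inj₂ (inj₂ (d₁ , proj₁ (lo≤gaps (wide w)) , arc₁₂ ey ex))
      pair (at₂ w ex) (at₀ ey)   = inj₂ (inj₁ (d₂ , proj₂ (lo≤gaps (wide w)) , arc₂₀ ex ey))
      pair (at₀ ex)   (at₂ w ey) = inj₂ (inj₂ (d₂ , proj₂ (lo≤gaps (wide w)) , arc₂₀ ey ex))

  mvPartition : MVPartition Adj k
  mvPartition = colour , λ i → arcCondition⇒IsMV (ColourClass.arcCondition i z≤n (λ _ → z≤n , z≤n))

  imvPartition : 2 ≤ k → (k + k < n → 2 ≤ d₁ × 2 ≤ d₂) → IMVPartition Adj k
  imvPartition 2≤k wide =
    colour , λ i → arcCondition⇒IsIMV (≤-trans 2≤k (≤-trans (m≤m+n k k) k+k≤n)) (ColourClass.arcCondition i 2≤k wide)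

widen : ∀ {n} → BlockGaps n → BlockGaps (3 + n)
widen g = record
  { k = suc k ; d₁ = suc d₁ ; d₂ = suc d₂
  ; n≡k+d₁+d₂ = trans (cong (3 +_) n≡k+d₁+d₂) (spread k d₁ d₂)
  ; d₁≤k = s≤s d₁≤k ; k≤1+d₁ = s≤s k≤1+d₁ ; d₂≤k = s≤s d₂≤k
  ; 0<d₁ = s≤s z≤n ; 0<d₂ = s≤s z≤n
  }
  where
  open BlockGaps g
  spread : ∀ k a b → 3 + (k + a + b) ≡ suc k + suc a + suc b
  spread = solve-∀

ceil3-gaps : ∀ n → 3 ≤ n → Σ (BlockGaps n) λ g → BlockGaps.k g ≡ ceil3 n
ceil3-gaps 0 ()
ceil3-gaps 1 (s≤s ())
ceil3-gaps 2 (s≤s (s≤s ()))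
ceil3-gaps 3 _ = record { k = 1 ; d₁ = 1 ; d₂ = 1 ; n≡k+d₁+d₂ = refl
                        ; d₁≤k = ≤-refl ; k≤1+d₁ = n≤1+n 1 ; d₂≤k = ≤-refl ; 0<d₁ = ≤-refl ; 0<d₂ = ≤-refl } , refl
ceil3-gaps 4 _ = record { k = 2 ; d₁ = 1 ; d₂ = 1 ; n≡k+d₁+d₂ = refl
                        ; d₁≤k = n≤1+n 1 ; k≤1+d₁ = ≤-refl ; d₂≤k = n≤1+n 1 ; 0<d₁ = ≤-refl ; 0<d₂ = ≤-refl } , refl
ceil3-gaps 5 _ = record { k = 2 ; d₁ = 1 ; d₂ = 2 ; n≡k+d₁+d₂ = refl
                        ; d₁≤k = n≤1+n 1 ; k≤1+d₁ = ≤-refl ; d₂≤k = ≤-refl ; 0<d₁ = ≤-refl ; 0<d₂ = s≤s z≤n } , refl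
ceil3-gaps (suc (suc (suc n@(suc (suc (suc _)))))) _ with ceil3-gaps n (s≤s (s≤s (s≤s z≤n)))
... | g , k≡ = widen g , trans (cong suc k≡) (sym (ceil3-+3 n))

ceil3-wideGaps : ∀ n → 6 ≤ n → Σ (BlockGaps n) λ g → let open BlockGaps g in
                 k ≡ ceil3 n × 2 ≤ k × 2 ≤ d₁ × 2 ≤ d₂
ceil3-wideGaps (suc (suc (suc n))) (s≤s (s≤s (s≤s 3≤n))) with ceil3-gaps n 3≤n
... | g , k≡ = widen g , trans (cong suc k≡) (sym (ceil3-+3 n)) , s≤s (≤-trans 0<d₁ d₁≤k) , s≤s 0<d₁ , s≤s 0<d₂
  where open BlockGaps g

imv⇒mvPartition : ∀ {V : Set} {Adj : V → V → Set} {k} → IMVPartition Adj k → MVPartition Adj k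
imv⇒mvPartition (c , imv) = c , λ i → proj₂ (imv i)

chiMu-cycle : ∀ n → 3 ≤ n → IsChiMu (CycleAdj n) (ceil3 n)
chiMu-cycle n 3≤n with ceil3-gaps n 3≤n
... | g , k≡ = subst (MVPartition (CycleAdj n)) k≡ (BlockColouring.mvPartition g) ,
               λ _ P → ceil3-least (Cycle.mvPartition-bound n P)

chiMuI-cycle : ∀ n → 6 ≤ n ⊎ n ≡ 4 → IsChiMuI (CycleAdj n) (ceil3 n)
chiMuI-cycle n 6≤n∨n≡4 =
  partition 6≤n∨n≡4 , λ _ P → ceil3-least (Cycle.mvPartition-bound n (imv⇒mvPartition P))
  where
  partition : 6 ≤ n ⊎ n ≡ 4 → IMVPartition (CycleAdj n) (ceil3 n)
  partition (inj₁ 6≤n) with ceil3-wideGaps n 6≤n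
  ... | g , k≡ , 2≤k , 2≤d₁ , 2≤d₂ =
    subst (IMVPartition (CycleAdj n)) k≡ (BlockColouring.imvPartition g 2≤k (λ _ → 2≤d₁ , 2≤d₂))
  partition (inj₂ refl) =
    BlockColouring.imvPartition (proj₁ (ceil3-gaps 4 (s≤s (s≤s (s≤s z≤n))))) ≤-refl (λ 4<4 → ⊥-elim (<-irrefl refl 4<4))

C₃-adjacent : ∀ (a b : Fin 3) → toℕ a < toℕ b → CycleAdj 3 a b
C₃-adjacent = from-yes (all? λ a → all? λ b → toℕ a <? toℕ b →-dec Cycle.Adj? 3 a b)

C₅-adjacent : ∀ (a b c : Fin 5) → toℕ a < toℕ b → toℕ b < toℕ c → CycleAdj 5 a b ⊎ CycleAdj 5 b c ⊎ CycleAdj 5 a c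
C₅-adjacent = from-yes (all? λ a → all? λ b → all? λ c → toℕ a <? toℕ b →-dec toℕ b <? toℕ c →-dec
  (Cycle.Adj? 5 a b ⊎-dec Cycle.Adj? 5 b c ⊎-dec Cycle.Adj? 5 a c))

C₅-colouring : Fin 5 → Fin 3
C₅-colouring = lookup (# 0 ∷ # 1 ∷ # 0 ∷ # 1 ∷ # 2 ∷ [])

C₅-colourClass? : ∀ i v → Dec (C₅-colouring v ≡ i)
C₅-colourClass? i v = C₅-colouring v ≟ᶠ i

C₅-arcCondition : ∀ i x y → C₅-colouring x ≡ i → C₅-colouring y ≡ i → Cycle.BoundedArcJoined 5 (C₅-colourClass? i) 2 x y
C₅-arcCondition = from-yes (all? λ i → Cycle.arcCondition? 5 (C₅-colourClass? i) 2)

chiMuI-C₃ : IsChiMuI (CycleAdj 3) 3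
chiMuI-C₃ = Cycle.singletonPartition 3 (s≤s (s≤s z≤n)) , lower
  where
  lower : ∀ k → IMVPartition (CycleAdj 3) k → 3 ≤ k
  lower k (c , imv) = subst (3 ≤_) (*-identityʳ k) (colourClasses-bound c 1 noPair)
    where
    noPair : ∀ i → ¬ ChainBelow (λ v → c v ≡ i) 2 3
    noPair i (y , _ , cy , x , x<y , cx , _) = proj₁ (imv i) x y cx cy (C₃-adjacent x y x<y)

chiMuI-C₅ : IsChiMuI (CycleAdj 5) 3
chiMuI-C₅ = upper , lower
  where
  upper : IMVPartition (CycleAdj 5) 3
  upper = C₅-colouring , λ i →
    Cycle.arcCondition⇒IsIMV 5 (s≤s (s≤s z≤n)) (Cycle.arcCondition-bounded 5 (C₅-colourClass? i) (C₅-arcCondition i))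
  5≤2k⇒3≤k : ∀ k → 5 ≤ k * 2 → 3 ≤ k
  5≤2k⇒3≤k k 5≤2k with 3 ≤? k
  ... | yes 3≤k = 3≤k
  ... | no  3≰k = ⊥-elim (<⇒≱ (s≤s (*-monoˡ-≤ 2 (s≤s⁻¹ (≰⇒> 3≰k)))) 5≤2k)
  lower : ∀ k → IMVPartition (CycleAdj 5) k → 3 ≤ k
  lower k (c , imv) = 5≤2k⇒3≤k k (colourClasses-bound c 2 noTriple)
    where
    independent : ∀ i → IsIndependent (CycleAdj 5) (λ v → c v ≡ i)
    independent i = proj₁ (imv i)
    noTriple : ∀ i → ¬ ChainBelow (λ v → c v ≡ i) 3 5
    noTriple i (z , _ , cz , y , y<z , cy , x , x<y , cx , _) with C₅-adjacent x y z x<y y<z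
    ... | inj₁ xy        = independent i x y cx cy xy
    ... | inj₂ (inj₁ yz) = independent i y z cy cz yz
    ... | inj₂ (inj₂ xz) = independent i x z cx cz xz

proposition4p6 : ((n : ℕ) → 3 ≤ n → (6 ≤ n ⊎ n ≡ 4) →
    IsChiMuI (CycleAdj n) (ceil3 n) × IsChiMu (CycleAdj n) (ceil3 n))
    × IsChiMuI (CycleAdj 3) 3 × IsChiMuI (CycleAdj 5) 3
    × IsChiMu (CycleAdj 5) 2 × IsChiMu (CycleAdj 3) 1
proposition4p6 =
  (λ n 3≤n 6≤n∨n≡4 → chiMuI-cycle n 6≤n∨n≡4 , chiMu-cycle n 3≤n) ,
  chiMuI-C₃ , chiMuI-C₅ , chiMu-cycle 5 (s≤s (s≤s (s≤s z≤n))) , chiMu-cycle 3 ≤-refl
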